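{- Let $\alpha=(a,b,A,B)$ be an arc of $\mathcal A_n$. The shard polytope $\mathrm{SP}(\alpha)$, defined as the convex hull of the characteristic vectors of all $\alpha$-alternating matchings, equals the set of $\mathbf x\in\mathbb R^n$ with $\sum_{i\in[n]}x_i=0$ satisfying: $x_i=0$ for all $i\in[n]\setminus[a,b]$; $x_{a'}\ge 0$ for all $a'\in A$; $x_{b'}\le 0$ for all $b'\in B$; $\sum_{i\le f}x_i\le 1$ for every $\alpha$-fall $f$; and $\sum_{i\le r}x_i\ge 0$ for every $\alpha$-rise $r$.
   Context: $[n]=\{1,\dots,n\}$, $[a,b]=\{a,\dots,b\}$, $]a,b[=\{a+1,\dots,b-1\}$, $(\mathbf e_i)$ is the standard basis of $\mathbb R^n$. An arc is a quadruple $\alpha=(a,b,A,B)$ with $1\le a<b\le n$ and $A\sqcup B=]a,b[$ (a partition); $\mathcal A_n$ is the set of arcs. An $\alpha$-alternating matching is a (possibly empty) set $M=\{a_1<b_1<a_2<b_2<\dots<a_k<b_k\}$ with $a\le a_1$, $b_k\le b$, $a_i\in\{a\}\cup A$ and $b_i\in B\cup\{b\}$ for all $i$; its characteristic vector is $\chi(M)=\sum_{i=1}^k(\mathbf e_{a_i}-\mathbf e_{b_i})$. An $\alpha$-fall is a $j\in[a,b-1]$ with $j\in\{a\}\cup A$ and $j+1\in B\cup\{b\}$; an $\alpha$-rise is a $j\in[a,b-1]$ with $j\in\{a\}\cup B$ and $j+1\in A\cup\{b\}$.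
   Formalization: Points have rational coordinates, lying in ℚ^n instead of ℝ^n, and the convex hull defining the shard polytope SP(α) takes only rational weights. -}

module Defs where

open import Data.Nat as ℕ using (ℕ; zero; suc; _≤ᵇ_; _≡ᵇ_)
open import Data.Bool using (Bool; true; false; if_then_else_)
open import Data.Fin using (Fin; toℕ)
open import Data.Rational as ℚ using (ℚ; 0ℚ; 1ℚ; _+_; _*_; _-_)
open import Data.List using (List; []; _∷_; foldr; map; concatMap)
open import Data.List.Relation.Unary.All using (All)
open import Data.List.Relation.Unary.Linked using (Linked)
open import Data.Product using (Σ; _×_; _,_; proj₁; proj₂; ∃)
open import Data.Sum using (_⊎_)
open import Relation.Binary.PropositionalEquality using (_≡_)

-- Paper indices are 1..n; coordinate i : Fin n of a vector corresponds to paper index suc (toℕ i).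
Vecℚ : ℕ → Set
Vecℚ n = Fin n → ℚ

idx : ∀ {n} → Fin n → ℕ
idx i = suc (toℕ i)

sumℚ : List ℚ → ℚ
sumℚ = foldr _+_ 0ℚ

allFinL : (n : ℕ) → List (Fin n)
allFinL n = Data.List.allFin n
  where import Data.List

-- The partition A ⊔ B of ]a,b[ is encoded by
-- `side`: for a < c < b, c ∈ A iff side c ≡ true, and c ∈ B iff side c ≡ false.
-- (Values of `side` outside ]a,b[ are irrelevant.)
record Arc (n : ℕ) : Set where
  field
    a b  : ℕ
    1≤a  : 1 ℕ.≤ a
    a<b  : a ℕ.< b
    b≤n  : b ℕ.≤ n
    side : ℕ → Bool
open Arc public

InA : ∀ {n} → Arc n → ℕ → Set
InA α c = (a α ℕ.< c) × (c ℕ.< b α) × (side α c ≡ true)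

InB : ∀ {n} → Arc n → ℕ → Set
InB α c = (a α ℕ.< c) × (c ℕ.< b α) × (side α c ≡ false)

Up : ∀ {n} → Arc n → ℕ → Set
Up α j = (j ≡ a α) ⊎ InA α j

Down : ∀ {n} → Arc n → ℕ → Set
Down α j = InB α j ⊎ (j ≡ b α)

-- A matching {a₁ < b₁ < … < a_k < b_k} is given as the list of pairs (a_i , b_i).
flatten : List (ℕ × ℕ) → List ℕ
flatten = concatMap (λ p → proj₁ p ∷ proj₂ p ∷ [])

record Alternating {n} (α : Arc n) (M : List (ℕ × ℕ)) : Set where
  field
    increasing : Linked ℕ._<_ (flatten M)
    lower      : All (λ c → a α ℕ.≤ c) (flatten M)
    upper      : All (λ c → c ℕ.≤ b α) (flatten M)
    ups        : All (λ p → Up α (proj₁ p)) M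
    downs      : All (λ p → Down α (proj₂ p)) M

δ : ℕ → ℕ → ℚ
δ k j = if k ≡ᵇ j then 1ℚ else 0ℚ

χ : ∀ {n} → List (ℕ × ℕ) → Vecℚ n
χ M i = sumℚ (map (λ p → δ (proj₁ p) (idx i) - δ (proj₂ p) (idx i)) M)

InSP : ∀ {n} → Arc n → Vecℚ n → Set
InSP α x =
  Σ (List (ℚ × List (ℕ × ℕ))) λ C →
    All (λ p → (0ℚ ℚ.≤ proj₁ p) × Alternating α (proj₂ p)) C
    × (sumℚ (map proj₁ C) ≡ 1ℚ)
    × (∀ i → x i ≡ sumℚ (map (λ p → proj₁ p * χ (proj₂ p) i) C))

Fall : ∀ {n} → Arc n → ℕ → Set
Fall α j = (a α ℕ.≤ j) × (j ℕ.< b α) × Up α j × Down α (suc j)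

Rise : ∀ {n} → Arc n → ℕ → Set
Rise α j = (a α ℕ.≤ j) × (j ℕ.< b α) × ((j ≡ a α) ⊎ InB α j)
           × (InA α (suc j) ⊎ (suc j ≡ b α))

prefixSum : ∀ {n} → Vecℚ n → ℕ → ℚ
prefixSum {n} x k = sumℚ (map (λ i → if idx i ≤ᵇ k then x i else 0ℚ) (allFinL n))

totalSum : ∀ {n} → Vecℚ n → ℚ
totalSum {n} x = sumℚ (map x (allFinL n))

InH : ∀ {n} → Arc n → Vecℚ n → Set
InH α x =
  (totalSum x ≡ 0ℚ)
  × (∀ i → (idx i ℕ.< a α) ⊎ (b α ℕ.< idx i) → x i ≡ 0ℚ)
  × (∀ i → InA α (idx i) → 0ℚ ℚ.≤ x i)
  × (∀ i → InB α (idx i) → x i ℚ.≤ 0ℚ)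
  × (∀ f → Fall α f → prefixSum x f ℚ.≤ 1ℚ)
  × (∀ r → Rise α r → 0ℚ ℚ.≤ prefixSum x r)

-- A vector is determined by its prefix sums S q = x₁ + … + x_q. For an α-alternating matching, S q of
-- χ(M) counts the aᵢ ≤ q minus the bᵢ ≤ q, which is 0 or 1, and vanishes outside [a , b); so every χ(M)
-- satisfies the inequalities, and so does every convex combination. Conversely, for x satisfying them,
-- S increases across A and decreases across B, hence is squeezed between its values at rises and falls,
-- so 0 ≤ S ≤ 1. For a threshold t > 0 the level set {q | t ≤ S q} is a union of intervals starting in
-- {a} ∪ A and ending just before B ∪ {b}: it is the set where the prefix sums of χ(M_t) equal 1, for
-- an alternating matching M_t. Slicing S at its finitely many values (a layer-cake decomposition) writes
-- x as a convex combination of the χ(M_t) and χ(∅).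
module Submission where

open import Defs
open import Data.Bool as Bool using (Bool; true; false; not; _∧_; if_then_else_)
import Data.Bool.Properties as Boolₚ
open import Data.Nat as ℕ using (ℕ; zero; suc; _≤ᵇ_; _≡ᵇ_; z≤n; s≤s)
import Data.Nat.Properties as ℕₚ
open import Data.Fin as Fin using (Fin; toℕ; fromℕ<)
import Data.Fin.Properties as Finₚ
open import Data.Rational as ℚ using (ℚ; 0ℚ; 1ℚ; _+_; _*_; _-_; -_)
import Data.Rational.Properties as ℚₚ
open import Data.Rational.Solver using (module +-*-Solver)
open import Data.List using (List; []; _∷_; map; upTo; filter)
import Data.List.Properties as Listₚ
import Data.List.Relation.Unary.All.Properties as AllP
open import Data.List.Membership.Propositional.Properties using (∈-map⁺; ∈-filter⁺; ∈-upTo⁺)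
open import Data.List.Relation.Binary.Permutation.Propositional using (↭-sym)
open import Data.List.Relation.Binary.Permutation.Propositional.Properties using (All-resp-↭; ∈-resp-↭)
open import Data.List.Sort ℚₚ.≤-decTotalOrder using (sort; sort-↭; sort-↗)
import Data.List.Relation.Unary.Linked.Properties as LinkedP
open import Data.List.Relation.Unary.All as All using (All; []; _∷_)
open import Data.List.Relation.Unary.Any using (here; there)
open import Data.List.Relation.Unary.Linked as Linked using (Linked; []; [-]; _∷_)
open import Data.List.Membership.Propositional using (_∈_)
open import Data.Product using (∃; _×_; _,_; proj₁; proj₂)
open import Data.Sum using (_⊎_; inj₁; inj₂; [_,_])
open import Function using (_∘_; flip)
open import Function.Bundles using (Equivalence)
open import Relation.Nullary using (yes; no; contradiction)
open import Relation.Nullary.Decidable using (dec-true; dec-false)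
open import Level using (0ℓ)
open import Relation.Binary.Core using (Rel)
open import Relation.Binary.Definitions using (Reflexive; Transitive)
open import Relation.Binary.PropositionalEquality
  using (_≡_; _≢_; refl; sym; trans; cong; cong₂; subst; subst₂; _≗_; module ≡-Reasoning)
open import Relation.Nullary.Reflects using (Reflects; ofʸ; ofⁿ; fromEquivalence)

open +-*-Solver using (solve; _:+_; _:-_; _:=_; con)
open import Algebra.Properties.Group ℚₚ.+-0-group using (∙-cancelˡ)

ind : Bool → ℚ
ind v = if v then 1ℚ else 0ℚ

0≤1 : 0ℚ ℚ.≤ 1ℚ
0≤1 = ℚₚ.≤ᵇ⇒≤ _

0≤ind : ∀ v → 0ℚ ℚ.≤ ind v
0≤ind true  = 0≤1
0≤ind false = ℚₚ.≤-refl

ind≤1 : ∀ v → ind v ℚ.≤ 1ℚ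
ind≤1 true  = ℚₚ.≤-refl
ind≤1 false = 0≤1

p≤q⇒0≤q-p : ∀ {p q} → p ℚ.≤ q → 0ℚ ℚ.≤ q - p
p≤q⇒0≤q-p {p} {q} p≤q = subst (ℚ._≤ q - p) (ℚₚ.+-inverseʳ p) (ℚₚ.+-monoˡ-≤ (- p) p≤q)

*-monoˡ-≤-nonNeg : ∀ {w u v} → 0ℚ ℚ.≤ w → u ℚ.≤ v → w * u ℚ.≤ w * v
*-monoˡ-≤-nonNeg {w} 0≤w = ℚₚ.*-monoˡ-≤-nonNeg w {{ℚ.nonNegative 0≤w}}

nonNeg*nonNeg≥0 : ∀ {w u} → 0ℚ ℚ.≤ w → 0ℚ ℚ.≤ u → 0ℚ ℚ.≤ w * u
nonNeg*nonNeg≥0 {w} {u} 0≤w 0≤u = subst (ℚ._≤ w * u) (ℚₚ.*-zeroʳ w) (*-monoˡ-≤-nonNeg 0≤w 0≤u)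

nonNeg*nonPos≤0 : ∀ {w u} → 0ℚ ℚ.≤ w → u ℚ.≤ 0ℚ → w * u ℚ.≤ 0ℚ
nonNeg*nonPos≤0 {w} {u} 0≤w u≤0 = subst (w * u ℚ.≤_) (ℚₚ.*-zeroʳ w) (*-monoˡ-≤-nonNeg 0≤w u≤0)

nonNeg*≤1≤ : ∀ {w u} → 0ℚ ℚ.≤ w → u ℚ.≤ 1ℚ → w * u ℚ.≤ w
nonNeg*≤1≤ {w} {u} 0≤w u≤1 = subst (w * u ℚ.≤_) (ℚₚ.*-identityʳ w) (*-monoˡ-≤-nonNeg 0≤w u≤1)

p≤p+q : ∀ {p q} → 0ℚ ℚ.≤ q → p ℚ.≤ p + q
p≤p+q {p} 0≤q = subst (ℚ._≤ p + _) (ℚₚ.+-identityʳ p) (ℚₚ.+-monoʳ-≤ p 0≤q)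

p+q≤p : ∀ {p q} → q ℚ.≤ 0ℚ → p + q ℚ.≤ p
p+q≤p {p} q≤0 = subst (p + _ ℚ.≤_) (ℚₚ.+-identityʳ p) (ℚₚ.+-monoʳ-≤ p q≤0)

≤ᵇ-reflects-≤ : ∀ p q → Reflects (p ℚ.≤ q) (p ℚ.≤ᵇ q)
≤ᵇ-reflects-≤ p q = fromEquivalence ℚₚ.≤ᵇ⇒≤ ℚₚ.≤⇒≤ᵇ

≤⇒≤ᵇ≡true : ∀ {p q} → p ℚ.≤ q → (p ℚ.≤ᵇ q) ≡ true
≤⇒≤ᵇ≡true = Equivalence.to Boolₚ.T-≡ ∘ ℚₚ.≤⇒≤ᵇ

≤ᵇ≡true⇒≤ : ∀ p q → (p ℚ.≤ᵇ q) ≡ true → p ℚ.≤ q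
≤ᵇ≡true⇒≤ p q = ℚₚ.≤ᵇ⇒≤ ∘ Equivalence.from Boolₚ.T-≡

>⇒≤ᵇ≡false : ∀ {p q} → q ℚ.< p → (p ℚ.≤ᵇ q) ≡ false
>⇒≤ᵇ≡false {p} {q} q<p =
  Boolₚ.¬-not λ p≤ᵇq → ℚₚ.<-irrefl refl (ℚₚ.<-≤-trans q<p (≤ᵇ≡true⇒≤ p q p≤ᵇq))

module _ {A : Set} where

  sum-map-cong : ∀ (f g : A → ℚ) {xs} → All (λ x → f x ≡ g x) xs →
                 sumℚ (map f xs) ≡ sumℚ (map g xs)
  sum-map-cong f g = cong sumℚ ∘ Listₚ.map-cong-local

  sum-map-zero : ∀ (f : A → ℚ) {xs} → All (λ x → f x ≡ 0ℚ) xs → sumℚ (map f xs) ≡ 0ℚ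
  sum-map-zero f []       = refl
  sum-map-zero f (e ∷ es) = cong₂ _+_ e (sum-map-zero f es)

  sum-map-mono : ∀ (f g : A → ℚ) {xs} → All (λ x → f x ℚ.≤ g x) xs →
                 sumℚ (map f xs) ℚ.≤ sumℚ (map g xs)
  sum-map-mono f g []       = ℚₚ.≤-refl
  sum-map-mono f g (h ∷ hs) = ℚₚ.+-mono-≤ h (sum-map-mono f g hs)

  sum-map-nonNeg : ∀ (f : A → ℚ) {xs} → All (λ x → 0ℚ ℚ.≤ f x) xs → 0ℚ ℚ.≤ sumℚ (map f xs)
  sum-map-nonNeg f []       = ℚₚ.≤-refl
  sum-map-nonNeg f (h ∷ hs) = ℚₚ.+-mono-≤ h (sum-map-nonNeg f hs)

  sum-map-nonPos : ∀ (f : A → ℚ) {xs} → All (λ x → f x ℚ.≤ 0ℚ) xs → sumℚ (map f xs) ℚ.≤ 0ℚ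
  sum-map-nonPos f []       = ℚₚ.≤-refl
  sum-map-nonPos f (h ∷ hs) = ℚₚ.+-mono-≤ h (sum-map-nonPos f hs)

  sum-map-+ : ∀ (f g : A → ℚ) xs →
              sumℚ (map (λ x → f x + g x) xs) ≡ sumℚ (map f xs) + sumℚ (map g xs)
  sum-map-+ f g []       = refl
  sum-map-+ f g (x ∷ xs) = trans (cong (f x + g x +_) (sum-map-+ f g xs))
    (interchange (f x) (g x) (sumℚ (map f xs)) (sumℚ (map g xs)))
    where
    interchange : ∀ p q r s → (p + q) + (r + s) ≡ (p + r) + (q + s)
    interchange = solve 4 (λ p q r s → (p :+ q) :+ (r :+ s) := (p :+ r) :+ (q :+ s)) refl

  sum-map-- : ∀ (f g : A → ℚ) xs →
              sumℚ (map (λ x → f x - g x) xs) ≡ sumℚ (map f xs) - sumℚ (map g xs)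
  sum-map-- f g []       = refl
  sum-map-- f g (x ∷ xs) = trans (cong (f x - g x +_) (sum-map-- f g xs))
    (interchange (f x) (g x) (sumℚ (map f xs)) (sumℚ (map g xs)))
    where
    interchange : ∀ p q r s → (p - q) + (r - s) ≡ (p + r) - (q + s)
    interchange = solve 4 (λ p q r s → (p :- q) :+ (r :- s) := (p :+ r) :- (q :+ s)) refl

  sum-map-*ˡ : ∀ c (f : A → ℚ) xs → sumℚ (map (λ x → c * f x) xs) ≡ c * sumℚ (map f xs)
  sum-map-*ˡ c f []       = sym (ℚₚ.*-zeroʳ c)
  sum-map-*ˡ c f (x ∷ xs) = trans (cong (c * f x +_) (sum-map-*ˡ c f xs)) (sym (ℚₚ.*-distribˡ-+ c _ _))

sum-allFin-suc : ∀ n (f : Fin (suc n) → ℚ) →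
                 sumℚ (map f (allFinL (suc n))) ≡ f Fin.zero + sumℚ (map (f ∘ Fin.suc) (allFinL n))
sum-allFin-suc n f = cong (λ xs → f Fin.zero + sumℚ xs)
  (trans (Listₚ.map-tabulate Fin.suc f) (sym (Listₚ.map-tabulate (λ i → i) (f ∘ Fin.suc))))

masked : ∀ {n} → Vecℚ n → ℕ → Fin n → ℚ
masked x q i = if idx i ≤ᵇ q then x i else 0ℚ

prefixSum-suc : ∀ {n} (x : Vecℚ (suc n)) q → prefixSum x (suc q) ≡ x Fin.zero + prefixSum (x ∘ Fin.suc) q
prefixSum-suc {n} x q = sum-allFin-suc n (masked x (suc q))

prefixSum-vanishing : ∀ {n} (x : Vecℚ n) q → (∀ i → idx i ℕ.≤ q → x i ≡ 0ℚ) → prefixSum x q ≡ 0ℚ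
prefixSum-vanishing {n} x q x≡0 = sum-map-zero (masked x q) (All.universal masked≡0 (allFinL n))
  where
  masked≡0 : ∀ i → masked x q i ≡ 0ℚ
  masked≡0 i with idx i ≤ᵇ q | ℕₚ.≤ᵇ-reflects-≤ (idx i) q
  ... | true  | ofʸ i≤q = x≡0 i i≤q
  ... | false | _       = refl

prefixSum-total : ∀ {n} (x : Vecℚ n) q → (∀ i → q ℕ.< idx i → x i ≡ 0ℚ) → prefixSum x q ≡ totalSum x
prefixSum-total {n} x q x≡0 = sum-map-cong (masked x q) x (All.universal masked≡x (allFinL n))
  where
  masked≡x : ∀ i → masked x q i ≡ x i
  masked≡x i with idx i ≤ᵇ q | ℕₚ.≤ᵇ-reflects-≤ (idx i) q
  ... | true  | _       = refl
  ... | false | ofⁿ i≰q = sym (x≡0 i (ℕₚ.≰⇒> i≰q))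

totalSum≡prefixSum : ∀ {n} (x : Vecℚ n) → totalSum x ≡ prefixSum x n
totalSum≡prefixSum {n} x =
  sym (prefixSum-total x n (λ i n<i → contradiction n<i (ℕₚ.≤⇒≯ (Finₚ.toℕ<n i))))

prefixSum-0 : ∀ {n} (x : Vecℚ n) → prefixSum x 0 ≡ 0ℚ
prefixSum-0 x = prefixSum-vanishing x 0 (λ _ ())

prefixSum-step : ∀ {n} (x : Vecℚ n) i → prefixSum x (idx i) ≡ prefixSum x (toℕ i) + x i
prefixSum-step x Fin.zero = begin
  prefixSum x 1                            ≡⟨ prefixSum-suc x 0 ⟩
  x Fin.zero + prefixSum (x ∘ Fin.suc) 0   ≡⟨ cong (x Fin.zero +_) (prefixSum-0 (x ∘ Fin.suc)) ⟩
  x Fin.zero + 0ℚ                          ≡⟨ ℚₚ.+-comm (x Fin.zero) 0ℚ ⟩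
  0ℚ + x Fin.zero                          ≡⟨ cong (_+ x Fin.zero) (prefixSum-0 x) ⟨
  prefixSum x 0 + x Fin.zero               ∎
  where open ≡-Reasoning
prefixSum-step x (Fin.suc i) = begin
  prefixSum x (suc (idx i))
    ≡⟨ prefixSum-suc x (idx i) ⟩
  x Fin.zero + prefixSum (x ∘ Fin.suc) (idx i)
    ≡⟨ cong (x Fin.zero +_) (prefixSum-step (x ∘ Fin.suc) i) ⟩
  x Fin.zero + (prefixSum (x ∘ Fin.suc) (toℕ i) + x (Fin.suc i))
    ≡⟨ ℚₚ.+-assoc (x Fin.zero) _ _ ⟨
  x Fin.zero + prefixSum (x ∘ Fin.suc) (toℕ i) + x (Fin.suc i)
    ≡⟨ cong (_+ x (Fin.suc i)) (prefixSum-suc x (toℕ i)) ⟨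
  prefixSum x (idx i) + x (Fin.suc i)
    ∎
  where open ≡-Reasoning

prefixSum-injective : ∀ {n} (x y : Vecℚ n) → (∀ q → prefixSum x q ≡ prefixSum y q) → ∀ i → x i ≡ y i
prefixSum-injective x y same i = ∙-cancelˡ (prefixSum x (toℕ i)) (x i) (y i) (begin
  prefixSum x (toℕ i) + x i   ≡⟨ prefixSum-step x i ⟨
  prefixSum x (idx i)         ≡⟨ same (idx i) ⟩
  prefixSum y (idx i)         ≡⟨ prefixSum-step y i ⟩
  prefixSum y (toℕ i) + y i   ≡⟨ cong (_+ y i) (same (toℕ i)) ⟨
  prefixSum x (toℕ i) + y i   ∎)
  where open ≡-Reasoning

prefixSum-suc-step : ∀ {n} (x : Vecℚ n) {t} (t<n : t ℕ.< n) →
                     prefixSum x (suc t) ≡ prefixSum x t + x (fromℕ< t<n)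
prefixSum-suc-step x t<n = subst (λ t → prefixSum x (suc t) ≡ prefixSum x t + x (fromℕ< t<n))
  (Finₚ.toℕ-fromℕ< t<n) (prefixSum-step x (fromℕ< t<n))

module _ {n : ℕ} where

  prefixSum-+ : ∀ (x y : Vecℚ n) q → prefixSum (λ i → x i + y i) q ≡ prefixSum x q + prefixSum y q
  prefixSum-+ x y q = begin
    sumℚ (map (masked (λ i → x i + y i) q) (allFinL n))
      ≡⟨ sum-map-cong _ (λ i → masked x q i + masked y q i)
                      (All.universal (λ i → split (idx i ≤ᵇ q)) (allFinL n)) ⟩
    sumℚ (map (λ i → masked x q i + masked y q i) (allFinL n))
      ≡⟨ sum-map-+ (masked x q) (masked y q) (allFinL n) ⟩
    prefixSum x q + prefixSum y q ∎
    where
    open ≡-Reasoning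
    split : ∀ v {u w} → (if v then u + w else 0ℚ) ≡ (if v then u else 0ℚ) + (if v then w else 0ℚ)
    split true  = refl
    split false = refl

  prefixSum-- : ∀ (x y : Vecℚ n) q → prefixSum (λ i → x i - y i) q ≡ prefixSum x q - prefixSum y q
  prefixSum-- x y q = begin
    sumℚ (map (masked (λ i → x i - y i) q) (allFinL n))
      ≡⟨ sum-map-cong _ (λ i → masked x q i - masked y q i)
                      (All.universal (λ i → split (idx i ≤ᵇ q)) (allFinL n)) ⟩
    sumℚ (map (λ i → masked x q i - masked y q i) (allFinL n))
      ≡⟨ sum-map-- (masked x q) (masked y q) (allFinL n) ⟩
    prefixSum x q - prefixSum y q ∎
    where
    open ≡-Reasoning
    split : ∀ v {u w} → (if v then u - w else 0ℚ) ≡ (if v then u else 0ℚ) - (if v then w else 0ℚ)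
    split true  = refl
    split false = refl

  prefixSum-*ˡ : ∀ c (x : Vecℚ n) q → prefixSum (λ i → c * x i) q ≡ c * prefixSum x q
  prefixSum-*ˡ c x q = begin
    sumℚ (map (masked (λ i → c * x i) q) (allFinL n))
      ≡⟨ sum-map-cong _ (λ i → c * masked x q i)
                      (All.universal (λ i → scale (idx i ≤ᵇ q)) (allFinL n)) ⟩
    sumℚ (map (λ i → c * masked x q i) (allFinL n))
      ≡⟨ sum-map-*ˡ c (masked x q) (allFinL n) ⟩
    c * prefixSum x q ∎
    where
    open ≡-Reasoning
    scale : ∀ v {u} → (if v then c * u else 0ℚ) ≡ c * (if v then u else 0ℚ)
    scale true  = refl
    scale false = sym (ℚₚ.*-zeroʳ c)

e : ∀ {n} → ℕ → Vecℚ n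
e c i = δ c (idx i)

prefixSum-e : ∀ {n} c q → 1 ℕ.≤ c → c ℕ.≤ n → prefixSum (e {n} c) q ≡ ind (c ≤ᵇ q)
prefixSum-e {suc n} (suc c) zero _ _ = prefixSum-0 (e {suc n} (suc c))
prefixSum-e {suc n} 1 (suc q) _ _ = begin
  prefixSum (e {suc n} 1) (suc q) ≡⟨ prefixSum-suc {n} (e 1) q ⟩
  1ℚ + prefixSum (e {n} 0) q      ≡⟨ cong (1ℚ +_) (prefixSum-vanishing (e {n} 0) q (λ _ _ → refl)) ⟩
  1ℚ                              ∎
  where open ≡-Reasoning
prefixSum-e {suc n} (suc (suc c)) (suc q) _ (s≤s c<n) = begin
  prefixSum (e {suc n} (2 ℕ.+ c)) (suc q) ≡⟨ prefixSum-suc {n} (e (2 ℕ.+ c)) q ⟩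
  0ℚ + prefixSum (e {n} (suc c)) q        ≡⟨ ℚₚ.+-identityˡ _ ⟩
  prefixSum (e {n} (suc c)) q             ≡⟨ prefixSum-e (suc c) q (s≤s z≤n) c<n ⟩
  ind (suc c ≤ᵇ q)                        ∎
  where open ≡-Reasoning

height : List (ℕ × ℕ) → ℕ → ℚ
height M q = sumℚ (map (λ p → ind (proj₁ p ≤ᵇ q) - ind (proj₂ p ≤ᵇ q)) M)

ind-≤ᵇ-false : ∀ {c q} → q ℕ.< c → ind (c ≤ᵇ q) ≡ 0ℚ
ind-≤ᵇ-false {c} {q} q<c = cong ind (dec-false (c ℕ.≤? q) (ℕₚ.<⇒≱ q<c))

ind-≤ᵇ-true : ∀ {c q} → c ℕ.≤ q → ind (c ≤ᵇ q) ≡ 1ℚ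
ind-≤ᵇ-true {c} {q} c≤q = cong ind (dec-true (c ℕ.≤? q) c≤q)

height-below : ∀ {M q} → All (q ℕ.<_) (flatten M) → height M q ≡ 0ℚ
height-below {[]}    []                  = refl
height-below {_ ∷ M} (q<c ∷ q<d ∷ above) =
  cong₂ _+_ (cong₂ _-_ (ind-≤ᵇ-false q<c) (ind-≤ᵇ-false q<d)) (height-below {M} above)

height-above : ∀ {M q} → All (ℕ._≤ q) (flatten M) → height M q ≡ 0ℚ
height-above {[]}    []                  = refl
height-above {_ ∷ M} (c≤q ∷ d≤q ∷ below) =
  cong₂ _+_ (cong₂ _-_ (ind-≤ᵇ-true c≤q) (ind-≤ᵇ-true d≤q)) (height-above {M} below)

height-indicator : ∀ M q → Linked ℕ._<_ (flatten M) → ∃ λ v → height M q ≡ ind v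
height-indicator []            q _  = false , refl
height-indicator ((c , d) ∷ M) q increasing with c ℕ.≤? q
... | no c≰q = false , height-below {(c , d) ∷ M}
                 (LinkedP.Linked⇒All ℕₚ.<-trans (ℕₚ.≰⇒> c≰q) increasing)
... | yes c≤q with d ℕ.≤? q
...   | no d≰q = true , cong₂ _+_ (cong₂ _-_ (ind-≤ᵇ-true c≤q) (ind-≤ᵇ-false (ℕₚ.≰⇒> d≰q)))
                   (height-below {M} (All.tail
                     (LinkedP.Linked⇒All ℕₚ.<-trans (ℕₚ.≰⇒> d≰q) (Linked.tail increasing))))
...   | yes d≤q = let v , h≡v = height-indicator M q (Linked.tail (Linked.tail increasing))
                  in v , trans (cong₂ _+_ (cong₂ _-_ (ind-≤ᵇ-true c≤q) (ind-≤ᵇ-true d≤q)) refl)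
                               (trans (ℚₚ.+-identityˡ (height M q)) h≡v)

prefixSum-χ : ∀ {n} M q → All (λ c → 1 ℕ.≤ c × c ℕ.≤ n) (flatten M) →
              prefixSum (χ {n} M) q ≡ height M q
prefixSum-χ {n} [] q [] = prefixSum-vanishing (χ {n} []) q (λ _ _ → refl)
prefixSum-χ {n} ((c , d) ∷ M) q ((1≤c , c≤n) ∷ (1≤d , d≤n) ∷ inRange) = begin
  prefixSum {n} (λ i → (e c i - e d i) + χ M i) q
    ≡⟨ prefixSum-+ {n} (λ i → e c i - e d i) (χ M) q ⟩
  prefixSum {n} (λ i → e c i - e d i) q + prefixSum (χ {n} M) q
    ≡⟨ cong₂ _+_ (prefixSum-- {n} (e c) (e d) q) (prefixSum-χ M q inRange) ⟩
  (prefixSum (e {n} c) q - prefixSum (e {n} d) q) + height M q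
    ≡⟨ cong (_+ height M q) (cong₂ _-_ (prefixSum-e c q 1≤c c≤n) (prefixSum-e d q 1≤d d≤n)) ⟩
  (ind (c ≤ᵇ q) - ind (d ≤ᵇ q)) + height M q
    ∎
  where open ≡-Reasoning

combination : ∀ {n} {B : Set} → (B → Vecℚ n) → List (ℚ × B) → Vecℚ n
combination v C i = sumℚ (map (λ p → proj₁ p * v (proj₂ p) i) C)

prefixSum-combination : ∀ {n} {B : Set} (v : B → Vecℚ n) C q →
  prefixSum (combination v C) q ≡ sumℚ (map (λ p → proj₁ p * prefixSum (v (proj₂ p)) q) C)
prefixSum-combination v []            q = prefixSum-vanishing (combination v []) q (λ _ _ → refl)
prefixSum-combination {n} v ((w , y) ∷ C) q = begin
  prefixSum {n} (λ i → w * v y i + combination v C i) q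
    ≡⟨ prefixSum-+ {n} (λ i → w * v y i) (combination v C) q ⟩
  prefixSum {n} (λ i → w * v y i) q + prefixSum (combination v C) q
    ≡⟨ cong₂ _+_ (prefixSum-*ˡ w (v y) q) (prefixSum-combination v C q) ⟩
  w * prefixSum (v y) q + sumℚ (map (λ p → proj₁ p * prefixSum (v (proj₂ p)) q) C)
    ∎
  where open ≡-Reasoning

-- The shard polytope lies in H

InH-resp-≗ : ∀ {n} (α : Arc n) {x y : Vecℚ n} → x ≗ y → InH α x → InH α y
InH-resp-≗ {n} α {x} {y} x≗y (sum≡0 , outside≡0 , A≥0 , B≤0 , falls≤1 , rises≥0) =
  trans (sym (cong sumℚ (Listₚ.map-cong x≗y (allFinL n)))) sum≡0 ,
  (λ i out → trans (sym (x≗y i)) (outside≡0 i out)) ,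
  (λ i i∈A → subst (0ℚ ℚ.≤_) (x≗y i) (A≥0 i i∈A)) ,
  (λ i i∈B → subst (ℚ._≤ 0ℚ) (x≗y i) (B≤0 i i∈B)) ,
  (λ f fall → subst (ℚ._≤ 1ℚ) (prefixSum-cong f) (falls≤1 f fall)) ,
  (λ r rise → subst (0ℚ ℚ.≤_) (prefixSum-cong r) (rises≥0 r rise))
  where
  prefixSum-cong : ∀ q → prefixSum x q ≡ prefixSum y q
  prefixSum-cong q =
    cong sumℚ (Listₚ.map-cong (λ i → cong (λ z → if idx i ≤ᵇ q then z else 0ℚ) (x≗y i)) (allFinL n))

InH-convex : ∀ {n} {B : Set} (α : Arc n) (v : B → Vecℚ n) C →
             All (λ p → 0ℚ ℚ.≤ proj₁ p × InH α (v (proj₂ p))) C → sumℚ (map proj₁ C) ≡ 1ℚ →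
             InH α (combination v C)
InH-convex {n} α v C inH total≡1 = sum≡0 , outside≡0 , A≥0 , B≤0 , falls≤1 , rises≥0
  where
  weightedPrefixSum : ∀ q → prefixSum (combination v C) q ≡
                            sumℚ (map (λ p → proj₁ p * prefixSum (v (proj₂ p)) q) C)
  weightedPrefixSum = prefixSum-combination v C

  sum≡0 : totalSum (combination v C) ≡ 0ℚ
  sum≡0 = begin
    totalSum (combination v C)                                ≡⟨ totalSum≡prefixSum (combination v C) ⟩
    prefixSum (combination v C) n                             ≡⟨ weightedPrefixSum n ⟩
    sumℚ (map (λ p → proj₁ p * prefixSum (v (proj₂ p)) n) C) ≡⟨ sum-map-zero _ (All.map term≡0 inH) ⟩
    0ℚ                                                        ∎
    where
    open ≡-Reasoning
    term≡0 : ∀ {p} → 0ℚ ℚ.≤ proj₁ p × InH α (v (proj₂ p)) →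
             proj₁ p * prefixSum (v (proj₂ p)) n ≡ 0ℚ
    term≡0 {w , y} (_ , sum≡0 , _) =
      trans (cong (w *_) (trans (sym (totalSum≡prefixSum (v y))) sum≡0)) (ℚₚ.*-zeroʳ w)

  outside≡0 : ∀ i → (idx i ℕ.< a α) ⊎ (b α ℕ.< idx i) → combination v C i ≡ 0ℚ
  outside≡0 i out = sum-map-zero _ (All.map (λ { {w , _} (_ , _ , out≡0 , _) →
                      trans (cong (w *_) (out≡0 i out)) (ℚₚ.*-zeroʳ w) }) inH)

  A≥0 : ∀ i → InA α (idx i) → 0ℚ ℚ.≤ combination v C i
  A≥0 i i∈A = sum-map-nonNeg _
    (All.map (λ (0≤w , _ , _ , A≥0 , _) → nonNeg*nonNeg≥0 0≤w (A≥0 i i∈A)) inH)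

  B≤0 : ∀ i → InB α (idx i) → combination v C i ℚ.≤ 0ℚ
  B≤0 i i∈B = sum-map-nonPos _
    (All.map (λ (0≤w , _ , _ , _ , B≤0 , _) → nonNeg*nonPos≤0 0≤w (B≤0 i i∈B)) inH)

  falls≤1 : ∀ f → Fall α f → prefixSum (combination v C) f ℚ.≤ 1ℚ
  falls≤1 f fall = subst₂ ℚ._≤_ (sym (weightedPrefixSum f)) total≡1
    (sum-map-mono _ proj₁
      (All.map (λ (0≤w , _ , _ , _ , _ , falls≤1 , _) → nonNeg*≤1≤ 0≤w (falls≤1 f fall)) inH))

  rises≥0 : ∀ r → Rise α r → 0ℚ ℚ.≤ prefixSum (combination v C) r
  rises≥0 r rise = subst (0ℚ ℚ.≤_) (sym (weightedPrefixSum r))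
    (sum-map-nonNeg _
      (All.map (λ (0≤w , _ , _ , _ , _ , _ , rises≥0) → nonNeg*nonNeg≥0 0≤w (rises≥0 r rise)) inH))

All-flatten⁻ : ∀ {P : ℕ → Set} M → All P (flatten M) → All (λ p → P (proj₁ p) × P (proj₂ p)) M
All-flatten⁻ []      []               = []
All-flatten⁻ (_ ∷ M) (Pc ∷ Pd ∷ rest) = (Pc , Pd) ∷ All-flatten⁻ M rest

δ-≢ : ∀ {c j} → c ≢ j → δ c j ≡ 0ℚ
δ-≢ {zero}  {zero}  c≢j = contradiction refl c≢j
δ-≢ {zero}  {suc j} _   = refl
δ-≢ {suc c} {zero}  _   = refl
δ-≢ {suc c} {suc j} c≢j = δ-≢ {c} {j} (c≢j ∘ cong suc)

0≤ind-0 : ∀ u → 0ℚ ℚ.≤ ind u - 0ℚ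
0≤ind-0 true  = 0≤1
0≤ind-0 false = ℚₚ.≤-refl

0-ind≤0 : ∀ u → 0ℚ - ind u ℚ.≤ 0ℚ
0-ind≤0 true  = ℚₚ.≤ᵇ⇒≤ _
0-ind≤0 false = ℚₚ.≤-refl

module _ {n} (α : Arc n) where

  Down⇒∉A : ∀ {d j} → Down α d → InA α j → d ≢ j
  Down⇒∉A (inj₁ (_ , _ , side≡false)) (_ , _   , side≡true) refl = Boolₚ.not-¬ side≡false side≡true
  Down⇒∉A (inj₂ refl)                 (_ , j<b , _)         refl = ℕₚ.<-irrefl refl j<b

  Up⇒∉B : ∀ {c j} → Up α c → InB α j → c ≢ j
  Up⇒∉B (inj₁ refl)                (a<j , _ , _)          refl = ℕₚ.<-irrefl refl a<j
  Up⇒∉B (inj₂ (_ , _ , side≡true)) (_   , _ , side≡false) refl = Boolₚ.not-¬ side≡false side≡true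

  prefixSum-χ-alternating : ∀ {M} → Alternating α M → ∀ q → prefixSum (χ {n} M) q ≡ height M q
  prefixSum-χ-alternating {M} alt q = prefixSum-χ M q
    (All.zipWith (λ (a≤c , c≤b) → ℕₚ.≤-trans (1≤a α) a≤c , ℕₚ.≤-trans c≤b (b≤n α))
                 (lower , upper))
    where open Alternating alt

  χ∈H : ∀ M → Alternating α M → InH α (χ {n} M)
  χ∈H M alt = sum≡0 , outside≡0 , A≥0 , B≤0 , falls≤1 , rises≥0
    where
    open Alternating alt
    prefixSum≡height : ∀ q → prefixSum (χ {n} M) q ≡ height M q
    prefixSum≡height = prefixSum-χ-alternating alt

    sum≡0 : totalSum (χ {n} M) ≡ 0ℚ
    sum≡0 = trans (totalSum≡prefixSum (χ {n} M)) (trans (prefixSum≡height n)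
              (height-above {M} (All.map (λ c≤b → ℕₚ.≤-trans c≤b (b≤n α)) upper)))

    outside≡0 : ∀ i → (idx i ℕ.< a α) ⊎ (b α ℕ.< idx i) → χ {n} M i ≡ 0ℚ
    outside≡0 i out = sum-map-zero _
      (All.map (λ ((a≤c , c≤b) , (a≤d , d≤b)) →
                  cong₂ _-_ (δ-≢ (≢idx a≤c c≤b)) (δ-≢ (≢idx a≤d d≤b)))
               (All-flatten⁻ M (All.zip (lower , upper))))
      where
      ≢idx : ∀ {c} → a α ℕ.≤ c → c ℕ.≤ b α → c ≢ idx i
      ≢idx a≤c c≤b refl = [ flip ℕₚ.<⇒≱ a≤c , flip ℕₚ.<⇒≱ c≤b ] out

    A≥0 : ∀ i → InA α (idx i) → 0ℚ ℚ.≤ χ {n} M i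
    A≥0 i i∈A = sum-map-nonNeg _ (All.map (λ { {c , d} d∈Down →
                  subst (λ z → 0ℚ ℚ.≤ δ c (idx i) - z) (sym (δ-≢ (Down⇒∉A d∈Down i∈A)))
                        (0≤ind-0 (c ≡ᵇ idx i)) }) downs)

    B≤0 : ∀ i → InB α (idx i) → χ {n} M i ℚ.≤ 0ℚ
    B≤0 i i∈B = sum-map-nonPos _ (All.map (λ { {c , d} c∈Up →
                  subst (λ z → z - δ d (idx i) ℚ.≤ 0ℚ) (sym (δ-≢ (Up⇒∉B c∈Up i∈B)))
                        (0-ind≤0 (d ≡ᵇ idx i)) }) ups)

    falls≤1 : ∀ f → Fall α f → prefixSum (χ {n} M) f ℚ.≤ 1ℚ
    falls≤1 f _ with height-indicator M f increasing
    ... | v , height≡v = subst (ℚ._≤ 1ℚ) (sym (trans (prefixSum≡height f) height≡v)) (ind≤1 v)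

    rises≥0 : ∀ r → Rise α r → 0ℚ ℚ.≤ prefixSum (χ {n} M) r
    rises≥0 r _ with height-indicator M r increasing
    ... | v , height≡v = subst (0ℚ ℚ.≤_) (sym (trans (prefixSum≡height r) height≡v)) (0≤ind v)

  SP⊆H : ∀ x → InSP α x → InH α x
  SP⊆H x (C , weighted , total≡1 , x≡C) =
    InH-resp-≗ α (sym ∘ x≡C)
      (InH-convex α χ C (All.map (λ (0≤w , alt) → 0≤w , χ∈H _ alt) weighted) total≡1)

-- Prefix sums of points of H lie in [0 , 1]

Side : ∀ {n} → Arc n → Bool → ℕ → Set
Side α s c = (a α ℕ.< c) × (c ℕ.< b α) × (side α c ≡ s)

-- Turn α true is Fall α and Turn α false is Rise α, definitionally.
Turn : ∀ {n} → Arc n → Bool → ℕ → Set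
Turn α s j = (a α ℕ.≤ j) × (j ℕ.< b α) × ((j ≡ a α) ⊎ Side α s j)
           × (Side α (not s) (suc j) ⊎ (suc j ≡ b α))

-- p climbs (in ⊑) across s-positions and descends across the others, so walking left from k to the
-- nearest s-position (or a), then right to the end of its run of s-positions, which is a turn, only climbs.
module _ {n} (α : Arc n) (s : Bool)
         (_⊑_ : Rel ℚ 0ℓ) (⊑-refl : Reflexive _⊑_) (⊑-trans : Transitive _⊑_) (p : ℕ → ℚ)
         (climb   : ∀ {t} → Side α s (suc t) → p t ⊑ p (suc t))
         (descend : ∀ {t} → Side α (not s) (suc t) → p (suc t) ⊑ p t) where

  private
    side-cases : ∀ c → side α c ≡ s ⊎ side α c ≡ not s
    side-cases c with side α c Bool.≟ s
    ... | yes ≡s = inj₁ ≡s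
    ... | no  ≢s = inj₂ (Boolₚ.¬-not ≢s)

  walk-back : ∀ k → a α ℕ.≤ k → k ℕ.< b α →
              ∃ λ j → a α ℕ.≤ j × j ℕ.< b α × ((j ≡ a α) ⊎ Side α s j) × p k ⊑ p j
  walk-back k a≤k k<b with ℕₚ.m≤n⇒m<n∨m≡n a≤k
  ... | inj₂ a≡k = k , a≤k , k<b , inj₁ (sym a≡k) , ⊑-refl
  walk-back (suc t) a≤k k<b | inj₁ a<k with side-cases (suc t)
  ... | inj₁ ≡s   = suc t , a≤k , k<b , inj₂ (a<k , k<b , ≡s) , ⊑-refl
  ... | inj₂ ≡¬s  =
    let j , a≤j , j<b , start , pt⊑pj = walk-back t (ℕₚ.≤-pred a<k) (ℕₚ.<-trans (ℕₚ.n<1+n t) k<b)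
    in j , a≤j , j<b , start , ⊑-trans (descend (a<k , k<b , ≡¬s)) pt⊑pj

  walk-forward : ∀ m j → m ℕ.+ suc j ≡ b α → a α ℕ.≤ j → ((j ≡ a α) ⊎ Side α s j) →
                 ∃ λ f → Turn α s f × p j ⊑ p f
  walk-forward zero    j 1+j≡b a≤j start =
    j , (a≤j , ℕₚ.≤-reflexive 1+j≡b , start , inj₂ 1+j≡b) , ⊑-refl
  walk-forward (suc m) j m+j≡b a≤j start
    with side-cases (suc j) | subst (suc j ℕ.<_) m+j≡b (s≤s (ℕₚ.m≤n+m (suc j) m))
  ... | inj₂ ≡¬s | 1+j<b =
    j , (a≤j , ℕₚ.<-trans (ℕₚ.n<1+n j) 1+j<b , start , inj₁ (s≤s a≤j , 1+j<b , ≡¬s)) , ⊑-refl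
  ... | inj₁ ≡s  | 1+j<b =
    let f , turn , p1+j⊑pf = walk-forward m (suc j) (trans (ℕₚ.+-suc m (suc j)) m+j≡b)
                                          (ℕₚ.m≤n⇒m≤1+n a≤j) (inj₂ (s≤s a≤j , 1+j<b , ≡s))
    in f , turn , ⊑-trans (climb (s≤s a≤j , 1+j<b , ≡s)) p1+j⊑pf

  reach-turn : ∀ k → a α ℕ.≤ k → k ℕ.< b α → ∃ λ f → Turn α s f × p k ⊑ p f
  reach-turn k a≤k k<b =
    let j , a≤j , j<b , start , pk⊑pj = walk-back k a≤k k<b
        f , turn , pj⊑pf         = walk-forward (b α ℕ.∸ suc j) j (ℕₚ.m∸n+n≡m j<b) a≤j start
    in f , turn , ⊑-trans pk⊑pj pj⊑pf

module _ {n} (α : Arc n) {x : Vecℚ n} where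

  private
    step-index : ∀ {t} → suc t ℕ.< b α → t ℕ.< n
    step-index {t} 1+t<b = ℕₚ.<-≤-trans (ℕₚ.<-trans (ℕₚ.n<1+n t) 1+t<b) (b≤n α)

    idx-fromℕ< : ∀ {t} (t<n : t ℕ.< n) → idx (fromℕ< t<n) ≡ suc t
    idx-fromℕ< t<n = cong suc (Finₚ.toℕ-fromℕ< t<n)

  prefixSum-mono-A : (∀ i → InA α (idx i) → 0ℚ ℚ.≤ x i) →
                     ∀ {t} → InA α (suc t) → prefixSum x t ℚ.≤ prefixSum x (suc t)
  prefixSum-mono-A A≥0 {t} t∈A@(_ , 1+t<b , _) =
    subst (prefixSum x t ℚ.≤_) (sym (prefixSum-suc-step x t<n))
      (p≤p+q (A≥0 (fromℕ< t<n) (subst (InA α) (sym (idx-fromℕ< t<n)) t∈A)))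
    where t<n = step-index 1+t<b

  prefixSum-anti-B : (∀ i → InB α (idx i) → x i ℚ.≤ 0ℚ) →
                     ∀ {t} → InB α (suc t) → prefixSum x (suc t) ℚ.≤ prefixSum x t
  prefixSum-anti-B B≤0 {t} t∈B@(_ , 1+t<b , _) =
    subst (ℚ._≤ prefixSum x t) (sym (prefixSum-suc-step x t<n))
      (p+q≤p (B≤0 (fromℕ< t<n) (subst (InB α) (sym (idx-fromℕ< t<n)) t∈B)))
    where t<n = step-index 1+t<b

  prefixSum-outside : InH α x → ∀ {q} → q ℕ.< a α ⊎ b α ℕ.≤ q → prefixSum x q ≡ 0ℚ
  prefixSum-outside (_ , outside≡0 , _) {q} (inj₁ q<a) =
    prefixSum-vanishing x q (λ i i≤q → outside≡0 i (inj₁ (ℕₚ.≤-<-trans i≤q q<a)))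
  prefixSum-outside (sum≡0 , outside≡0 , _) {q} (inj₂ b≤q) =
    trans (prefixSum-total x q (λ i q<i → outside≡0 i (inj₂ (ℕₚ.≤-<-trans b≤q q<i)))) sum≡0

  private
    0∈[0,1] : ∀ {z} → z ≡ 0ℚ → 0ℚ ℚ.≤ z × z ℚ.≤ 1ℚ
    0∈[0,1] refl = ℚₚ.≤-refl , 0≤1

  prefixSum-bounded : InH α x → ∀ q → 0ℚ ℚ.≤ prefixSum x q × prefixSum x q ℚ.≤ 1ℚ
  prefixSum-bounded x∈H@(_ , _ , A≥0 , B≤0 , falls≤1 , rises≥0) q with q ℕ.<? a α | b α ℕ.≤? q
  ... | yes q<a | _       = 0∈[0,1] (prefixSum-outside x∈H (inj₁ q<a))
  ... | no _    | yes b≤q = 0∈[0,1] (prefixSum-outside x∈H (inj₂ b≤q))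
  ... | no q≮a  | no b≰q  =
    let a≤q = ℕₚ.≮⇒≥ q≮a
        q<b = ℕₚ.≰⇒> b≰q
        f , fall , pq≤pf = reach-turn α true  ℚ._≤_        ℚₚ.≤-refl ℚₚ.≤-trans        (prefixSum x)
                             (prefixSum-mono-A A≥0) (prefixSum-anti-B B≤0) q a≤q q<b
        r , rise , pr≤pq = reach-turn α false (flip ℚ._≤_) ℚₚ.≤-refl (flip ℚₚ.≤-trans) (prefixSum x)
                             (prefixSum-anti-B B≤0) (prefixSum-mono-A A≥0) q a≤q q<b
    in ℚₚ.≤-trans (rises≥0 r rise) pr≤pq , ℚₚ.≤-trans pq≤pf (falls≤1 f fall)

-- Maximal runs of a Boolean sequence

≤ᵇ-suc : ∀ k q → (suc k ≤ᵇ suc q) ≡ (k ≤ᵇ q)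
≤ᵇ-suc zero    q = refl
≤ᵇ-suc (suc k) q = refl

ind-≤ᵇ∧-suc-true : ∀ k q v → (k ≡ q → v ≡ true) →
                     (ind (k ≤ᵇ q) - ind (suc k ≤ᵇ q)) + ind ((suc k ≤ᵇ q) ∧ v) ≡ ind ((k ≤ᵇ q) ∧ v)
ind-≤ᵇ∧-suc-true zero    zero    v k≡q⇒v rewrite k≡q⇒v refl = refl
ind-≤ᵇ∧-suc-true zero    (suc q) v _     = ℚₚ.+-identityˡ (ind v)
ind-≤ᵇ∧-suc-true (suc k) zero    v _     = refl
ind-≤ᵇ∧-suc-true (suc k) (suc q) v k≡q⇒v rewrite ≤ᵇ-suc k q =
  ind-≤ᵇ∧-suc-true k q v (k≡q⇒v ∘ cong suc)

ind-≤ᵇ∧-suc-false : ∀ k q v → (k ≡ q → v ≡ false) →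
                     ind ((suc k ≤ᵇ q) ∧ v) ≡ ind ((k ≤ᵇ q) ∧ v)
ind-≤ᵇ∧-suc-false zero    zero    v k≡q⇒¬v rewrite k≡q⇒¬v refl = refl
ind-≤ᵇ∧-suc-false zero    (suc q) v _      = refl
ind-≤ᵇ∧-suc-false (suc k) zero    v _      = refl
ind-≤ᵇ∧-suc-false (suc k) (suc q) v k≡q⇒¬v rewrite ≤ᵇ-suc k q =
  ind-≤ᵇ∧-suc-false k q v (k≡q⇒¬v ∘ cong suc)

-- runs k m lists the maximal intervals [c , d) ⊆ [k , k + m) on which I holds (a run reaching k + m is
-- closed there); runsFrom s k m does the same while the run started at s < k is still open at k.
module Runs (I : ℕ → Bool) where

  runs     : ℕ → ℕ → List (ℕ × ℕ)
  runsFrom : ℕ → ℕ → ℕ → List (ℕ × ℕ)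
  runs k zero    = []
  runs k (suc m) = if I k then runsFrom k (suc k) m else runs (suc k) m
  runsFrom s k zero    = (s , k) ∷ []
  runsFrom s k (suc m) = if I k then runsFrom s (suc k) m else (s , k) ∷ runs (suc k) m

  runs-increasing     : ∀ {lo} k m → lo ℕ.< k → Linked ℕ._<_ (lo ∷ flatten (runs k m))
  runsFrom-increasing : ∀ {lo} s k m → lo ℕ.< s → s ℕ.< k → Linked ℕ._<_ (lo ∷ flatten (runsFrom s k m))
  runs-increasing k zero    lo<k = [-]
  runs-increasing k (suc m) lo<k with I k
  ... | true  = runsFrom-increasing k (suc k) m lo<k (ℕₚ.n<1+n k)
  ... | false = runs-increasing (suc k) m (ℕₚ.m<n⇒m<1+n lo<k)
  runsFrom-increasing s k zero    lo<s s<k = lo<s ∷ s<k ∷ [-]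
  runsFrom-increasing s k (suc m) lo<s s<k with I k
  ... | true  = runsFrom-increasing s (suc k) m lo<s (ℕₚ.m<n⇒m<1+n s<k)
  ... | false = lo<s ∷ s<k ∷ runs-increasing (suc k) m (ℕₚ.n<1+n k)

  -- The first pair of runsFrom s k m is the only one that depends on s.
  height-runsFrom : ∀ s k m q →
                    height (runsFrom s k m) q ≡ (ind (s ≤ᵇ q) - ind (k ≤ᵇ q)) + height (runs k m) q
  height-runsFrom s k zero    q = refl
  height-runsFrom s k (suc m) q with I k
  ... | false = refl
  ... | true  = begin
    height (runsFrom s (suc k) m) q
      ≡⟨ height-runsFrom s (suc k) m q ⟩
    (ind (s ≤ᵇ q) - ind (suc k ≤ᵇ q)) + height (runs (suc k) m) q
      ≡⟨ telescope (ind (s ≤ᵇ q)) (ind (k ≤ᵇ q)) (ind (suc k ≤ᵇ q)) (height (runs (suc k) m) q) ⟩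
    (ind (s ≤ᵇ q) - ind (k ≤ᵇ q)) + ((ind (k ≤ᵇ q) - ind (suc k ≤ᵇ q)) + height (runs (suc k) m) q)
      ≡⟨ cong ((ind (s ≤ᵇ q) - ind (k ≤ᵇ q)) +_) (height-runsFrom k (suc k) m q) ⟨
    (ind (s ≤ᵇ q) - ind (k ≤ᵇ q)) + height (runsFrom k (suc k) m) q
      ∎
    where
    open ≡-Reasoning
    telescope : ∀ u v w h → (u - w) + h ≡ (u - v) + ((v - w) + h)
    telescope = solve 4 (λ u v w h → (u :- w) :+ h := (u :- v) :+ ((v :- w) :+ h)) refl

  private
    vanishing-suc : ∀ k m → (∀ q → k ℕ.+ suc m ℕ.≤ q → I q ≡ false) →
                    ∀ q → suc k ℕ.+ m ℕ.≤ q → I q ≡ false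
    vanishing-suc k m I≡false q = I≡false q ∘ subst (ℕ._≤ q) (sym (ℕₚ.+-suc k m))

  height-runs : ∀ k m → (∀ q → k ℕ.+ m ℕ.≤ q → I q ≡ false) →
                ∀ q → height (runs k m) q ≡ ind ((k ≤ᵇ q) ∧ I q)
  height-runs k zero    I≡false q with k ≤ᵇ q | ℕₚ.≤ᵇ-reflects-≤ k q
  ... | false | _      = refl
  ... | true  | ofʸ k≤q rewrite I≡false q (subst (ℕ._≤ q) (sym (ℕₚ.+-identityʳ k)) k≤q) = refl
  height-runs k (suc m) I≡false q with I k in Ik
  ... | true  = begin
    height (runsFrom k (suc k) m) q
      ≡⟨ height-runsFrom k (suc k) m q ⟩
    (ind (k ≤ᵇ q) - ind (suc k ≤ᵇ q)) + height (runs (suc k) m) q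
      ≡⟨ cong (ind (k ≤ᵇ q) - ind (suc k ≤ᵇ q) +_) (height-runs (suc k) m (vanishing-suc k m I≡false) q) ⟩
    (ind (k ≤ᵇ q) - ind (suc k ≤ᵇ q)) + ind ((suc k ≤ᵇ q) ∧ I q)
      ≡⟨ ind-≤ᵇ∧-suc-true k q (I q) (λ { refl → Ik }) ⟩
    ind ((k ≤ᵇ q) ∧ I q)
      ∎
    where open ≡-Reasoning
  ... | false = trans (height-runs (suc k) m (vanishing-suc k m I≡false) q)
                      (ind-≤ᵇ∧-suc-false k q (I q) (λ { refl → Ik }))

All-flatten⁺ : ∀ {P : ℕ → Set} {M} → All (λ p → P (proj₁ p) × P (proj₂ p)) M → All P (flatten M)
All-flatten⁺ []                = []
All-flatten⁺ ((Pc , Pd) ∷ rest) = Pc ∷ Pd ∷ All-flatten⁺ rest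

module _ {n} (α : Arc n) where

  Up⇒inArc : ∀ {c} → Up α c → a α ℕ.≤ c × c ℕ.≤ b α
  Up⇒inArc (inj₁ refl)           = ℕₚ.≤-refl , ℕₚ.<⇒≤ (a<b α)
  Up⇒inArc (inj₂ (a<c , c<b , _)) = ℕₚ.<⇒≤ a<c , ℕₚ.<⇒≤ c<b

  Down⇒inArc : ∀ {d} → Down α d → a α ℕ.≤ d × d ℕ.≤ b α
  Down⇒inArc (inj₁ (a<d , d<b , _)) = ℕₚ.<⇒≤ a<d , ℕₚ.<⇒≤ d<b
  Down⇒inArc (inj₂ refl)           = ℕₚ.<⇒≤ (a<b α) , ℕₚ.≤-refl

module _ {n} (α : Arc n) (I : ℕ → Bool)
         (spread-A : ∀ {t} → InA α (suc t) → I t ≡ true → I (suc t) ≡ true)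
         (spread-B : ∀ {t} → InB α (suc t) → I (suc t) ≡ true → I t ≡ true) where

  open Runs I

  private
    m+1+n≡o⇒m<o : ∀ m {n o} → m ℕ.+ suc n ≡ o → m ℕ.< o
    m+1+n≡o⇒m<o m m+1+n≡o = subst (m ℕ.<_) m+1+n≡o (ℕₚ.m<m+n m ℕ.z<s)

    1+k+m≡b : ∀ {k m} → k ℕ.+ suc m ≡ b α → suc k ℕ.+ m ≡ b α
    1+k+m≡b {k} {m} = trans (sym (ℕₚ.+-suc k m))

    CanStart : ℕ → Set
    CanStart k = k ≡ a α ⊎ (a α ℕ.< k × I (ℕ.pred k) ≡ false)

    CanStart⇒a≤ : ∀ {k} → CanStart k → a α ℕ.≤ k
    CanStart⇒a≤ (inj₁ refl)      = ℕₚ.≤-refl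
    CanStart⇒a≤ (inj₂ (a<k , _)) = ℕₚ.<⇒≤ a<k

    start⇒Up : ∀ k → CanStart k → k ℕ.< b α → I k ≡ true → Up α k
    start⇒Up k       (inj₁ k≡a)              _   _  = inj₁ k≡a
    start⇒Up (suc t) (inj₂ (a<k , It≡false)) k<b Ik with side α (suc t) in side≡
    ... | true  = inj₂ (a<k , k<b , refl)
    ... | false = contradiction (spread-B (a<k , k<b , side≡) Ik) (Boolₚ.not-¬ It≡false)

    end⇒Down : ∀ k → a α ℕ.< k → k ℕ.< b α → I (ℕ.pred k) ≡ true → I k ≡ false → Down α k
    end⇒Down (suc t) a<k k<b It Ik≡false with side α (suc t) in side≡
    ... | false = inj₁ (a<k , k<b , refl)
    ... | true  = contradiction (spread-A (a<k , k<b , side≡) It) (Boolₚ.not-¬ Ik≡false)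

    UpDown : ℕ × ℕ → Set
    UpDown p = Up α (proj₁ p) × Down α (proj₂ p)

    runs-UpDown     : ∀ k m → k ℕ.+ m ≡ b α → CanStart k → All UpDown (runs k m)
    runsFrom-UpDown : ∀ s k m → k ℕ.+ m ≡ b α → Up α s → a α ℕ.≤ s → s ℕ.< k →
                      I (ℕ.pred k) ≡ true → All UpDown (runsFrom s k m)
    runs-UpDown k zero    _     _     = []
    runs-UpDown k (suc m) k+m≡b start with I k in Ik
    ... | true  = runsFrom-UpDown k (suc k) m (1+k+m≡b k+m≡b)
                    (start⇒Up k start (m+1+n≡o⇒m<o k k+m≡b) Ik) (CanStart⇒a≤ start) (ℕₚ.n<1+n k) Ik
    ... | false = runs-UpDown (suc k) m (1+k+m≡b k+m≡b) (inj₂ (s≤s (CanStart⇒a≤ start) , Ik))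
    runsFrom-UpDown s k zero    k+0≡b s∈Up _   _   _  =
      (s∈Up , inj₂ (trans (sym (ℕₚ.+-identityʳ k)) k+0≡b)) ∷ []
    runsFrom-UpDown s k (suc m) k+m≡b s∈Up a≤s s<k Ik-1 with I k in Ik
    ... | true  = runsFrom-UpDown s (suc k) m (1+k+m≡b k+m≡b) s∈Up a≤s (ℕₚ.m<n⇒m<1+n s<k) Ik
    ... | false = (s∈Up , end⇒Down k (ℕₚ.≤-<-trans a≤s s<k) (m+1+n≡o⇒m<o k k+m≡b) Ik-1 Ik)
                  ∷ runs-UpDown (suc k) m (1+k+m≡b k+m≡b)
                      (inj₂ (s≤s (ℕₚ.≤-trans a≤s (ℕₚ.<⇒≤ s<k)) , Ik))

  runs-alternating : Alternating α (runs (a α) (b α ℕ.∸ a α))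
  runs-alternating = record
    { increasing = Linked.tail (runs-increasing {0} (a α) (b α ℕ.∸ a α) (1≤a α))
    ; lower      = All.map proj₁ inArc
    ; upper      = All.map proj₂ inArc
    ; ups        = All.map proj₁ upDown
    ; downs      = All.map proj₂ upDown
    }
    where
    upDown : All UpDown (runs (a α) (b α ℕ.∸ a α))
    upDown = runs-UpDown (a α) (b α ℕ.∸ a α) (ℕₚ.m+[n∸m]≡n (ℕₚ.<⇒≤ (a<b α))) (inj₁ refl)
    inArc : All (λ c → a α ℕ.≤ c × c ℕ.≤ b α) (flatten (runs (a α) (b α ℕ.∸ a α)))
    inArc = All-flatten⁺ (All.map (λ (c∈Up , d∈Down) → Up⇒inArc α c∈Up , Down⇒inArc α d∈Down) upDown)

-- H lies in the shard polytope

increments : ℚ → List ℚ → List (ℚ × ℚ)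
increments t₀ []       = []
increments t₀ (t ∷ ts) = (t - t₀ , t) ∷ increments t ts

increments-All : ∀ {P : ℚ → Set} t₀ {ts} → All P ts → All (λ p → P (proj₂ p)) (increments t₀ ts)
increments-All t₀ []         = []
increments-All t₀ (Pt ∷ Pts) = Pt ∷ increments-All _ Pts

increments-nonNeg : ∀ t₀ ts → Linked ℚ._≤_ (t₀ ∷ ts) →
                    All (λ p → 0ℚ ℚ.≤ proj₁ p) (increments t₀ ts)
increments-nonNeg t₀ []       _               = []
increments-nonNeg t₀ (t ∷ ts) (t₀≤t ∷ sorted) = p≤q⇒0≤q-p t₀≤t ∷ increments-nonNeg t ts sorted

sum-increments≤ : ∀ t₀ ts → Linked ℚ._≤_ (t₀ ∷ ts) → All (ℚ._≤ 1ℚ) (t₀ ∷ ts) →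
                  sumℚ (map proj₁ (increments t₀ ts)) ℚ.≤ 1ℚ - t₀
sum-increments≤ t₀ []       _            (t₀≤1 ∷ []) = p≤q⇒0≤q-p t₀≤1
sum-increments≤ t₀ (t ∷ ts) (_ ∷ sorted) (_ ∷ ≤1)    =
  subst ((t - t₀) + sumℚ (map proj₁ (increments t ts)) ℚ.≤_) (telescope t₀ t)
    (ℚₚ.+-monoʳ-≤ (t - t₀) (sum-increments≤ t ts sorted ≤1))
  where
  telescope : ∀ t₀ t → (t - t₀) + (1ℚ - t) ≡ 1ℚ - t₀
  telescope = solve 2 (λ t₀ t → (t :- t₀) :+ (con 1ℚ :- t) := con 1ℚ :- t₀) refl

layer-cake : ∀ t₀ ts {v} → Linked ℚ._≤_ (t₀ ∷ ts) → v ∈ t₀ ∷ ts →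
             sumℚ (map (λ p → proj₁ p * ind (proj₂ p ℚ.≤ᵇ v)) (increments t₀ ts)) ≡ v - t₀
layer-cake t₀ []       _               (here refl) = sym (ℚₚ.+-inverseʳ t₀)
layer-cake t₀ (t ∷ ts) {v} (t₀≤t ∷ sorted) v∈ with t ℚ.≤ᵇ v | ≤ᵇ-reflects-≤ t v
... | true  | ofʸ t≤v = begin
  (t - t₀) * 1ℚ + layers t
    ≡⟨ cong₂ _+_ (ℚₚ.*-identityʳ (t - t₀)) (layer-cake t ts sorted (v∈t∷ts v∈)) ⟩
  (t - t₀) + (v - t)
    ≡⟨ telescope t₀ t v ⟩
  v - t₀
    ∎
  where
  open ≡-Reasoning
  layers : ℚ → ℚ
  layers t = sumℚ (map (λ p → proj₁ p * ind (proj₂ p ℚ.≤ᵇ v)) (increments t ts))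
  telescope : ∀ t₀ t v → (t - t₀) + (v - t) ≡ v - t₀
  telescope = solve 3 (λ t₀ t v → (t :- t₀) :+ (v :- t) := v :- t₀) refl
  v∈t∷ts : v ∈ t₀ ∷ t ∷ ts → v ∈ t ∷ ts
  v∈t∷ts (here v≡t₀) = here (ℚₚ.≤-antisym (subst (ℚ._≤ t) (sym v≡t₀) t₀≤t) t≤v)
  v∈t∷ts (there v∈)  = v∈
... | false | ofⁿ t≰v = begin
  (t - t₀) * 0ℚ + sumℚ (map (λ p → proj₁ p * ind (proj₂ p ℚ.≤ᵇ v)) (increments t ts))
    ≡⟨ cong₂ _+_ (ℚₚ.*-zeroʳ (t - t₀)) (sum-map-zero _ (All.map (λ { {w , _} v<t′ →
         trans (cong (λ u → w * ind u) (>⇒≤ᵇ≡false v<t′)) (ℚₚ.*-zeroʳ w) })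
         (increments-All t v<ts))) ⟩
  0ℚ
    ≡⟨ trans (cong (_- t₀) (v≡t₀ v∈)) (ℚₚ.+-inverseʳ t₀) ⟨
  v - t₀
    ∎
  where
  open ≡-Reasoning
  t≤t∷ts : All (t ℚ.≤_) (t ∷ ts)
  t≤t∷ts = LinkedP.Linked⇒All ℚₚ.≤-trans ℚₚ.≤-refl sorted
  v<ts : All (v ℚ.<_) ts
  v<ts = All.map (ℚₚ.<-≤-trans (ℚₚ.≰⇒> t≰v)) (All.tail t≤t∷ts)
  v≡t₀ : v ∈ t₀ ∷ t ∷ ts → v ≡ t₀
  v≡t₀ (here v≡t₀) = v≡t₀
  v≡t₀ (there v∈)  = contradiction (All.lookup t≤t∷ts v∈) t≰v

module _ {n} (α : Arc n) {x : Vecℚ n} (x∈H : InH α x) where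

  private
    A≥0 : ∀ i → InA α (idx i) → 0ℚ ℚ.≤ x i
    A≥0 = let _ , _ , A≥0 , _ = x∈H in A≥0

    B≤0 : ∀ i → InB α (idx i) → x i ℚ.≤ 0ℚ
    B≤0 = let _ , _ , _ , B≤0 , _ = x∈H in B≤0

    values : List ℚ
    values = map (prefixSum x) (upTo (b α))

    candidates : List ℚ
    candidates = filter (0ℚ ℚ.<?_) values

  -- Only positive values are used as thresholds: for t > 0 the set where t ≤ prefixSum x lies inside
  -- [a , b), because the prefix sums vanish outside.
  thresholds : List ℚ
  thresholds = sort candidates

  thresholds-positive : All (0ℚ ℚ.<_) thresholds
  thresholds-positive = All-resp-↭ (↭-sym (sort-↭ candidates)) (AllP.all-filter (0ℚ ℚ.<?_) values)

  thresholds-≤1 : All (ℚ._≤ 1ℚ) thresholds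
  thresholds-≤1 = All-resp-↭ (↭-sym (sort-↭ candidates))
    (AllP.filter⁺ (0ℚ ℚ.<?_) (AllP.map⁺ (All.universal (proj₂ ∘ prefixSum-bounded α x∈H) (upTo (b α)))))

  thresholds-sorted : Linked ℚ._≤_ (0ℚ ∷ thresholds)
  thresholds-sorted = cons (All.map ℚₚ.<⇒≤ thresholds-positive) (sort-↗ candidates)
    where
    cons : ∀ {ts} → All (0ℚ ℚ.≤_) ts → Linked ℚ._≤_ ts → Linked ℚ._≤_ (0ℚ ∷ ts)
    cons []          _      = [-]
    cons (0≤t ∷ _)   sorted = 0≤t ∷ sorted

  prefixSum∈thresholds : ∀ q → prefixSum x q ∈ 0ℚ ∷ thresholds
  prefixSum∈thresholds q with 0ℚ ℚ.<? prefixSum x q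
  ... | no  ¬pos = here (ℚₚ.≤-antisym (ℚₚ.≮⇒≥ ¬pos) (proj₁ (prefixSum-bounded α x∈H q)))
  ... | yes pos  = there (∈-resp-↭ (↭-sym (sort-↭ candidates))
                     (∈-filter⁺ (0ℚ ℚ.<?_) (∈-map⁺ (prefixSum x) (∈-upTo⁺ q<b)) pos))
    where
    q<b : q ℕ.< b α
    q<b = ℕₚ.≰⇒> (λ b≤q → ℚₚ.<-irrefl (sym (prefixSum-outside α x∈H (inj₂ b≤q))) pos)

  level : ℚ → ℕ → Bool
  level t q = t ℚ.≤ᵇ prefixSum x q

  matching : ℚ → List (ℕ × ℕ)
  matching t = Runs.runs (level t) (a α) (b α ℕ.∸ a α)

  level-spreads-A : ∀ t {u} → InA α (suc u) → level t u ≡ true → level t (suc u) ≡ true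
  level-spreads-A t {u} u∈A t≤u =
    ≤⇒≤ᵇ≡true (ℚₚ.≤-trans (≤ᵇ≡true⇒≤ t (prefixSum x u) t≤u) (prefixSum-mono-A α A≥0 u∈A))

  level-spreads-B : ∀ t {u} → InB α (suc u) → level t (suc u) ≡ true → level t u ≡ true
  level-spreads-B t {u} u∈B t≤u =
    ≤⇒≤ᵇ≡true (ℚₚ.≤-trans (≤ᵇ≡true⇒≤ t (prefixSum x (suc u)) t≤u) (prefixSum-anti-B α B≤0 u∈B))

  matching-alternating : ∀ t → Alternating α (matching t)
  matching-alternating t = runs-alternating α (level t) (level-spreads-A t) (level-spreads-B t)

  height-matching : ∀ {t} → 0ℚ ℚ.< t → ∀ q → height (matching t) q ≡ ind (level t q)
  height-matching {t} 0<t q =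
    trans (Runs.height-runs (level t) (a α) (b α ℕ.∸ a α) beyond q) (cong ind inside)
    where
    outside : ∀ {q} → q ℕ.< a α ⊎ b α ℕ.≤ q → level t q ≡ false
    outside out = >⇒≤ᵇ≡false (subst (ℚ._< t) (sym (prefixSum-outside α x∈H out)) 0<t)
    beyond : ∀ q → a α ℕ.+ (b α ℕ.∸ a α) ℕ.≤ q → level t q ≡ false
    beyond q = outside ∘ inj₂ ∘ subst (ℕ._≤ q) (ℕₚ.m+[n∸m]≡n (ℕₚ.<⇒≤ (a<b α)))
    inside : ((a α ≤ᵇ q) ∧ level t q) ≡ level t q
    inside with a α ≤ᵇ q | ℕₚ.≤ᵇ-reflects-≤ (a α) q
    ... | true  | _       = refl
    ... | false | ofⁿ a≰q = sym (outside (inj₁ (ℕₚ.≰⇒> a≰q)))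

  layers : List (ℚ × List (ℕ × ℕ))
  layers = map (λ p → proj₁ p , matching (proj₂ p)) (increments 0ℚ thresholds)

  decomposition : List (ℚ × List (ℕ × ℕ))
  decomposition = (1ℚ - sumℚ (map proj₁ layers) , []) ∷ layers

  decomposition-valid : All (λ p → 0ℚ ℚ.≤ proj₁ p × Alternating α (proj₂ p)) decomposition
  decomposition-valid = (p≤q⇒0≤q-p layers≤1 , empty-alternating)
                      ∷ AllP.map⁺ (All.map (λ { {_ , t} 0≤w → 0≤w , matching-alternating t })
                                           (increments-nonNeg 0ℚ thresholds thresholds-sorted))
    where
    layers≤1 : sumℚ (map proj₁ layers) ℚ.≤ 1ℚ
    layers≤1 = subst (ℚ._≤ 1ℚ) (cong sumℚ (Listₚ.map-∘ (increments 0ℚ thresholds)))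
                 (sum-increments≤ 0ℚ thresholds thresholds-sorted (0≤1 ∷ thresholds-≤1))
    empty-alternating : Alternating α []
    empty-alternating = record { increasing = [] ; lower = [] ; upper = [] ; ups = [] ; downs = [] }

  decomposition-total : sumℚ (map proj₁ decomposition) ≡ 1ℚ
  decomposition-total = rest (sumℚ (map proj₁ layers))
    where
    rest : ∀ w → (1ℚ - w) + w ≡ 1ℚ
    rest = solve 1 (λ w → (con 1ℚ :- w) :+ w := con 1ℚ) refl

  prefixSum-decomposition : ∀ q → prefixSum (combination (χ {n}) decomposition) q ≡ prefixSum x q
  prefixSum-decomposition q = begin
    prefixSum (combination (χ {n}) decomposition) q
      ≡⟨ prefixSum-combination (χ {n}) decomposition q ⟩
    sumℚ (map (λ p → proj₁ p * prefixSum (χ {n} (proj₂ p)) q) decomposition)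
      ≡⟨ sum-map-cong _ _ (All.map (λ { {w , _} (_ , alt) → cong (w *_) (prefixSum-χ-alternating α alt q) })
                                   decomposition-valid) ⟩
    (1ℚ - sumℚ (map proj₁ layers)) * 0ℚ + heights
      ≡⟨ trans (cong (_+ heights) (ℚₚ.*-zeroʳ (1ℚ - sumℚ (map proj₁ layers)))) (ℚₚ.+-identityˡ heights) ⟩
    heights
      ≡⟨ cong sumℚ (Listₚ.map-∘ (increments 0ℚ thresholds)) ⟨
    sumℚ (map (λ p → proj₁ p * height (matching (proj₂ p)) q) (increments 0ℚ thresholds))
      ≡⟨ sum-map-cong _ _ (All.map (λ { {w , t} 0<t → cong (w *_) (height-matching 0<t q) })
                                   (increments-All 0ℚ thresholds-positive)) ⟩
    sumℚ (map (λ p → proj₁ p * ind (proj₂ p ℚ.≤ᵇ prefixSum x q)) (increments 0ℚ thresholds))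
      ≡⟨ layer-cake 0ℚ thresholds thresholds-sorted (prefixSum∈thresholds q) ⟩
    prefixSum x q - 0ℚ
      ≡⟨ ℚₚ.+-identityʳ (prefixSum x q) ⟩
    prefixSum x q
      ∎
    where
    open ≡-Reasoning
    heights : ℚ
    heights = sumℚ (map (λ p → proj₁ p * height (proj₂ p) q) layers)

  H⊆SP : InSP α x
  H⊆SP = decomposition , decomposition-valid , decomposition-total ,
         prefixSum-injective x (combination (χ {n}) decomposition) (sym ∘ prefixSum-decomposition)

proposition40 : (n : ℕ) (α : Arc n) (x : Vecℚ n) →
    (InSP α x → InH α x) × (InH α x → InSP α x)
proposition40 n α x = SP⊆H α x , H⊆SP α
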